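{- Let $k\in\mathbb{N}$. Then $$P'_{2k+1,2k+3}=\{(a,b)\in\mathbb{N}^2 \mid a+b\le 2k-1 \text{ if } b\ge k,\ \text{and } a+b\le 2k \text{ if } b<k\}.$$
   Context: $\mathbb{N}$ denotes the non-negative integers. For coprime positive integers $s,t$, let $F_{s,t}=st-s-t$ and $P'_{s,t}=\{(a,b)\in\mathbb{N}^2 \mid as+bt\le F_{s,t}\}$. -}

module Defs where

open import Data.Nat using (ℕ; _+_; _*_; _≤_; _<_; _≥_)
open import Data.Integer as ℤ using (ℤ; +_)
open import Data.Product using (_×_)

-- Frobenius number F_{s,t} = st - s - t, computed in ℤ (it can be negative,
-- e.g. s = 1).
F : ℕ → ℕ → ℤ
F s t = (+ (s * t) ℤ.- + s) ℤ.- + t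

InP' : ℕ → ℕ → ℕ → ℕ → Set
InP' s t a b = + (a * s + b * t) ℤ.≤ F s t

-- The right-hand side set, with conditions in ℤ since 2k - 1 may be -1.
InRHS : ℕ → ℕ → ℕ → Set
InRHS k a b = (b ≥ k → + (a + b) ℤ.≤ (+ (2 * k) ℤ.- + 1))
            × (b < k → a + b ≤ 2 * k)

-- Since t = s + 2, the inequality a s + b t ≤ s t - s - t reads (a + b) s + 2 (b + 1) ≤ s², so with
-- m = a + b it compares the "row" m and the "remainder" 2 (b + 1) ≤ 2 (m + 1) against s² = 2k·s + s.
-- Rows m < 2k always fit, rows m > 2k never do, and on the row m = 2k the point fits exactly
-- when 2 (b + 1) ≤ 2k + 1, i.e. b < k.
module Submission where

open import Defs
open import Data.Nat using (ℕ; suc; _+_; _*_)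
open import Function.Bundles using (_⇔_)

open import Data.Nat using (_≤_; _<_; _≤?_; _<?_; z<s)
open import Data.Nat.Properties
open import Data.Nat.Tactic.RingSolver using (solve)
open import Data.List.Base using (_∷_; [])
open import Data.Integer as ℤ using (+_)
import Data.Integer.Properties as ℤₚ
open import Data.Integer.Properties using (pos-+; neg-distrib-+; drop‿+≤+)
open import Algebra.Bundles using (AbelianGroup)
open import Algebra.Properties.Group (AbelianGroup.group ℤₚ.+-0-abelianGroup)
  using (//-rightDividesˡ; //-rightDividesʳ)
open import Data.Product using (_×_; _,_; map₁)
open import Function.Base using (_∘_)
open import Function.Bundles using (mk⇔; Equivalence)
open import Function.Construct.Composition using (_⇔-∘_)
open import Function.Properties.Equivalence using (⇔-setoid)
open import Level using (0ℓ)
open import Relation.Binary.PropositionalEquality using (_≡_; _≢_; refl; sym; cong; subst; subst₂; module ≡-Reasoning)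
open import Relation.Nullary using (yes; no; contradiction)

open Equivalence using (to; from)

i≤j-k⇔i+k≤j : ∀ i j k → i ℤ.≤ j ℤ.- k ⇔ i ℤ.+ k ℤ.≤ j
i≤j-k⇔i+k≤j i j k = mk⇔
  (λ i≤j-k → ℤₚ.≤-trans (ℤₚ.+-monoˡ-≤ k i≤j-k) (ℤₚ.≤-reflexive (//-rightDividesˡ k j)))
  (λ i+k≤j → ℤₚ.≤-trans (ℤₚ.≤-reflexive (sym (//-rightDividesʳ k i))) (ℤₚ.+-monoˡ-≤ (ℤ.- k) i+k≤j))

+≤+⇔≤ : ∀ {m n} → + m ℤ.≤ + n ⇔ m ≤ n
+≤+⇔≤ = mk⇔ drop‿+≤+ ℤ.+≤+

+m≤+n-+d⇔m+d≤n : ∀ m n d → + m ℤ.≤ + n ℤ.- + d ⇔ m + d ≤ n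
+m≤+n-+d⇔m+d≤n m n d = subst (λ i → i ℤ.≤ + n ⇔ m + d ≤ n) (pos-+ m d) +≤+⇔≤
                        ⇔-∘ i≤j-k⇔i+k≤j (+ m) (+ n) (+ d)

F≡st-[s+t] : ∀ s t → F s t ≡ + (s * t) ℤ.- + (s + t)
F≡st-[s+t] s t = begin
  (+ (s * t) ℤ.- + s) ℤ.- + t        ≡⟨ ℤₚ.+-assoc (+ (s * t)) (ℤ.- + s) (ℤ.- + t) ⟩
  + (s * t) ℤ.+ (ℤ.- + s ℤ.- + t)    ≡⟨ cong (λ i → + (s * t) ℤ.+ i) (sym (neg-distrib-+ (+ s) (+ t))) ⟩
  + (s * t) ℤ.- (+ s ℤ.+ + t)        ≡⟨ cong (λ i → + (s * t) ℤ.- i) (sym (pos-+ s t)) ⟩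
  + (s * t) ℤ.- + (s + t)            ∎
  where open ≡-Reasoning

InP'⇔ : ∀ s t a b → InP' s t a b ⇔ a * s + b * t + (s + t) ≤ s * t
InP'⇔ s t a b =
  subst (λ f → + (a * s + b * t) ℤ.≤ f ⇔ a * s + b * t + (s + t) ≤ s * t) (sym (F≡st-[s+t] s t))
        (+m≤+n-+d⇔m+d≤n (a * s + b * t) (s * t) (s + t))

InRHS⇔ : ∀ k a b → InRHS k a b ⇔ ((k ≤ b → a + b < 2 * k) × (b < k → a + b ≤ 2 * k))
InRHS⇔ k a b = mk⇔ (map₁ (to below ∘_)) (map₁ (from below ∘_))
  where
  below : + (a + b) ℤ.≤ + (2 * k) ℤ.- + 1 ⇔ a + b < 2 * k
  below = subst (λ n → + (a + b) ℤ.≤ + (2 * k) ℤ.- + 1 ⇔ n ≤ 2 * k) (+-comm (a + b) 1)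
                (+m≤+n-+d⇔m+d≤n (a + b) (2 * k) 1)

as+bt+[s+t]≤st⇔[a+b]s+2[1+b]≤ss : ∀ {s t} a b → t ≡ s + 2 →
  a * s + b * t + (s + t) ≤ s * t ⇔ (a + b) * s + 2 * suc b ≤ s * s
as+bt+[s+t]≤st⇔[a+b]s+2[1+b]≤ss {s} a b refl =
  subst₂ (λ l r → l ≤ r ⇔ (a + b) * s + 2 * suc b ≤ s * s) (sym lhs) (sym rhs)
    (mk⇔ (+-cancelʳ-≤ (s + s) _ _) (+-monoˡ-≤ (s + s)))
  where
  lhs : a * s + b * (s + 2) + (s + (s + 2)) ≡ (a + b) * s + 2 * suc b + (s + s)
  lhs = solve (a ∷ b ∷ s ∷ [])
  rhs : s * (s + 2) ≡ s * s + (s + s)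
  rhs = solve (s ∷ [])

m*s+[1+r]≤n*s+s⇒m≤n : ∀ {s m n r} → m * s + suc r ≤ n * s + s → m ≤ n
m*s+[1+r]≤n*s+s⇒m≤n {s} {m} {n} {r} h with m ≤? n
... | yes m≤n = m≤n
... | no m≰n = contradiction h (<⇒≱ (begin-strict
  n * s + s      ≡⟨ +-comm (n * s) s ⟩
  suc n * s      ≤⟨ *-monoˡ-≤ s (≰⇒> m≰n) ⟩
  m * s          <⟨ m<m+n (m * s) z<s ⟩
  m * s + suc r  ∎))
  where open ≤-Reasoning

m<n⇒m*s+r≤n*s+s : ∀ {s m n r} → m < n → r ≤ 2 * s → m * s + r ≤ n * s + s
m<n⇒m*s+r≤n*s+s {s} {m} {n} {r} m<n r≤2s = begin
  m * s + r      ≤⟨ +-monoʳ-≤ (m * s) r≤2s ⟩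
  m * s + 2 * s  ≡⟨ solve (m ∷ s ∷ []) ⟩
  suc m * s + s  ≤⟨ +-monoˡ-≤ s (*-monoˡ-≤ s m<n) ⟩
  n * s + s      ∎
  where open ≤-Reasoning

2[1+b]≤2k+1⇔b<k : ∀ {b k} → 2 * suc b ≤ 2 * k + 1 ⇔ b < k
2[1+b]≤2k+1⇔b<k {b} {k} = mk⇔ to′ (λ b<k → ≤-trans (*-monoʳ-≤ 2 b<k) (m≤m+n (2 * k) 1))
  where
  to′ : 2 * suc b ≤ 2 * k + 1 → b < k
  to′ h with b <? k
  ... | yes b<k = b<k
  ... | no b≮k = contradiction h (<⇒≱ (begin-strict
    2 * k + 1  ≡⟨ +-comm (2 * k) 1 ⟩
    suc (2 * k) <⟨ n<1+n _ ⟩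
    2 + 2 * k  ≤⟨ +-monoʳ-≤ 2 (*-monoʳ-≤ 2 (≮⇒≥ b≮k)) ⟩
    2 + 2 * b  ≡⟨ sym (*-suc 2 b) ⟩
    2 * suc b  ∎))
    where open ≤-Reasoning

m[2k+1]+2[1+b]≤[2k+1]²⇔ : ∀ {k m b} → b ≤ m →
  m * (2 * k + 1) + 2 * suc b ≤ (2 * k + 1) * (2 * k + 1) ⇔
  ((k ≤ b → m < 2 * k) × (b < k → m ≤ 2 * k))
m[2k+1]+2[1+b]≤[2k+1]²⇔ {k} {m} {b} b≤m =
  subst (λ r → m * s + 2 * suc b ≤ r ⇔ ((k ≤ b → m < 2 * k) × (b < k → m ≤ 2 * k)))
        (sym square) (mk⇔ to′ from′)
  where
  s : ℕ
  s = 2 * k + 1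

  square : (2 * k + 1) * (2 * k + 1) ≡ 2 * k * (2 * k + 1) + (2 * k + 1)
  square = solve (k ∷ [])

  to′ : m * s + 2 * suc b ≤ 2 * k * s + s → (k ≤ b → m < 2 * k) × (b < k → m ≤ 2 * k)
  to′ h = (λ k≤b → ≤∧≢⇒< m≤2k (m≢2k k≤b)) , λ _ → m≤2k
    where
    m≤2k : m ≤ 2 * k
    m≤2k = m*s+[1+r]≤n*s+s⇒m≤n h
    m≢2k : k ≤ b → m ≢ 2 * k
    m≢2k k≤b refl = <⇒≱ (to 2[1+b]≤2k+1⇔b<k (+-cancelˡ-≤ (2 * k * s) _ _ h)) k≤b

  from′ : (k ≤ b → m < 2 * k) × (b < k → m ≤ 2 * k) → m * s + 2 * suc b ≤ 2 * k * s + s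
  from′ (below , top) with k ≤? b
  ... | yes k≤b = m<n⇒m*s+r≤n*s+s m<2k (*-monoʳ-≤ 2 b<s)
    where
    m<2k : m < 2 * k
    m<2k = below k≤b
    b<s : b < s
    b<s = ≤-trans (≤-<-trans b≤m m<2k) (m≤m+n (2 * k) 1)
  ... | no k≰b = +-mono-≤ (*-monoˡ-≤ s (top (≰⇒> k≰b))) (from 2[1+b]≤2k+1⇔b<k (≰⇒> k≰b))

lemma3p3 : (k a b : ℕ) → InP' (2 * k + 1) (2 * k + 3) a b ⇔ InRHS k a b
lemma3p3 k a b = begin
  InP' s t a b                                          ≈⟨ InP'⇔ s t a b ⟩
  a * s + b * t + (s + t) ≤ s * t                       ≈⟨ as+bt+[s+t]≤st⇔[a+b]s+2[1+b]≤ss a b t≡s+2 ⟩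
  (a + b) * s + 2 * suc b ≤ s * s                       ≈⟨ m[2k+1]+2[1+b]≤[2k+1]²⇔ (m≤n+m b a) ⟩
  ((k ≤ b → a + b < 2 * k) × (b < k → a + b ≤ 2 * k))  ≈⟨ InRHS⇔ k a b ⟨
  InRHS k a b                                           ∎
  where
  s t : ℕ
  s = 2 * k + 1
  t = 2 * k + 3
  t≡s+2 : t ≡ s + 2
  t≡s+2 = sym (+-assoc (2 * k) 1 2)
  open import Relation.Binary.Reasoning.Setoid (⇔-setoid 0ℓ)
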